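{- Fix $k\in\mathbb Z_{\ge0}$ and an irreducible fraction $t\in(0,1)$, and write $m_t=m_{k,t}$ and $u_t^\pm=u^\pm_{k,t}$, $v^\pm_t=v^\pm_{k,t}$. Then (1) $0<u_t^+,v_t^-<\frac{m_t}{2}$ and $\frac{m_t}{2}<u_t^-,v_t^+<m_t$; (2) $u_t^-=m_t-u_t^+$, $v_t^+=m_t-u_t^+-k$, and $v_t^-=u_t^++k$.
   Context: Fix $k\in\mathbb Z_{\ge0}$. The Farey tree $\mathrm{F}\mathbb T$ is the rooted binary tree with root $\left(\frac01,\frac11,\frac10\right)$ in which each vertex $\left(\frac ab,\frac cd,\frac ef\right)$ has left child $\left(\frac ab,\frac{a+c}{b+d},\frac cd\right)$ and right child $\left(\frac cd,\frac{c+e}{d+f},\frac ef\right)$; every positive irreducible fraction is the middle entry of exactly one vertex. $\mathrm{M}\mathbb T(k)$ is the rooted binary tree with root $(1,k+2,1)$ in which each vertex $(a,b,c)$ has left child $\left(a,\frac{a^2+kab+b^2}{c},b\right)$ and right child $\left(b,\frac{b^2+kbc+c^2}{a},c\right)$ (all entries are positive integers). Let $\theta$ be the unique bijection $\mathrm{F}\mathbb T\to\mathrm{M}\mathbb T(k)$ sending root to root and left (resp. right) children to left (resp. right) children. For an irreducible $t\in(0,1)$, let $(r,t,s)$ be the vertex of $\mathrm{F}\mathbb T$ with middle entry $t$ and $(m_r,m_t,m_s):=\theta(r,t,s)$; set $m_{k,t}:=m_t$. The characteristic numbers $u^+_{k,t},u^-_{k,t},v^+_{k,t},v^-_{k,t}$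 are the unique integers $x\in(0,m_t)$ satisfying respectively $m_rx\equiv m_s$, $m_rx\equiv -m_s$, $m_sx\equiv m_r$, $m_sx\equiv -m_r \pmod{m_t}$. -}

module Defs where

open import Data.Nat using (ℕ; zero; suc; _+_; _*_; _<_)
open import Data.Product using (_×_; _,_)
open import Data.List using (List; []; _∷_)
open import Data.Integer as ℤ using (ℤ; +_)
open import Data.Integer.Divisibility using () renaming (_∣_ to _∣ℤ_)
open import Relation.Binary.PropositionalEquality using (_≡_)

data Dir : Set where
  L R : Dir

-- Convention: the path is stored most-recent-step-first, so that the
-- left (resp. right) child of the vertex with path p has path L ∷ p
-- (resp. R ∷ p); the root has path [].
Path : Set
Path = List Dir

-- A fraction a/b represented by the pair (a , b) (numerator, denominator).
Frac : Set
Frac = ℕ × ℕ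

mediant : Frac → Frac → Frac
mediant (a , b) (c , d) = (a + c , b + d)

farey : Path → Frac × Frac × Frac
farey [] = ((0 , 1) , (1 , 1) , (1 , 0))
farey (L ∷ p) with farey p
... | (x , y , z) = (x , mediant x y , y)
farey (R ∷ p) with farey p
... | (x , y , z) = (y , mediant y z , z)

-- The child entries (a²+kab+b²)/c are given as the
-- (exact) quotient, i.e. the unique natural number n with c * n = a²+kab+b².
data MT (k : ℕ) : Path → ℕ → ℕ → ℕ → Set where
  root  : MT k [] 1 (k + 2) 1
  left  : ∀ {p a b c n} → MT k p a b c →
          c * n ≡ a * a + k * a * b + b * b → MT k (L ∷ p) a n b
  right : ∀ {p a b c n} → MT k p a b c →
          a * n ≡ b * b + k * b * c + c * c → MT k (R ∷ p) b n c

_≡_[mod_] : ℤ → ℤ → ℕ → Set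
x ≡ y [mod m ] = (+ m) ∣ℤ (x ℤ.- y)

IsCharPos : ℕ → ℕ → ℕ → ℕ → Set
IsCharPos m a b x = 0 < x × x < m × (+ (a * x)) ≡ (+ b) [mod m ]

IsCharNeg : ℕ → ℕ → ℕ → ℕ → Set
IsCharNeg m a b x = 0 < x × x < m × (+ (a * x)) ≡ (ℤ.- (+ b)) [mod m ]

module Submission where

-- At every vertex (x, y, z) = (m_r, m_t, m_s) of MT(k) there are P, q, w ∈ ℕ with
--   x q = z + y P   and   y w = x + z (q + k).
-- They exist at the root, and each mutation (a, b, c) ↦ (a, (a² + kab + b²)/c, b), or its right
-- analogue, transports them; the new q is integral by Euclid's lemma because neighbouring entries
-- are coprime.  Read modulo y these identities say u⁺ = q and v⁻ = q + k once q + k < y, while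
-- u⁻ = y - u⁺ and v⁺ = y - v⁻ hold for the characteristic numbers of any coprime pair.  The size
-- bound comes from (2 + k) w ≤ z, valid on the left subtree (t < 1):
--   z (2 + k)(q + k) < (2 + k) y w ≤ y z,  hence  2 (q + k) < y.

open import Defs
open import Data.Nat using (ℕ; _+_; _*_; _<_)
open import Data.Nat.Coprimality using (Coprime)
open import Data.Product using (_×_; _,_)
open import Relation.Binary.PropositionalEquality using (_≡_)

open import Data.Nat using (suc; _≤_; _∸_; _⊔_; z≤n; s≤s; NonZero; >-nonZero)
open import Data.Nat.Properties
open import Data.Nat.Divisibility
  using (_∣_; divides; ∣-trans; ∣m+n∣m⇒∣n; ∣m∣n⇒∣m+n; ∣m⇒∣m*n; ∣n⇒∣m*n; m∣m*n; >⇒∤)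
import Data.Nat.Coprimality as Coprimality
open import Data.Nat.Tactic.RingSolver using (solve)
import Data.Integer as ℤ
open ℤ using (ℤ; +_)
import Data.Integer.Properties as ℤₚ
import Data.Integer.Divisibility.Signed as Signed
import Data.Integer.Coprimality as ℤCoprimality
open import Data.Integer.Tactic.RingSolver using () renaming (solve-∀ to ℤ-solve-∀)
open import Data.List using ([]; _∷_)
open import Data.Product using (Σ-syntax; proj₁; proj₂)
open import Data.Sum as Sum using (_⊎_; inj₁; inj₂)
open import Relation.Nullary using (contradiction)
open import Relation.Binary.PropositionalEquality
  using (refl; sym; trans; cong; cong₂; subst; module ≡-Reasoning)

∣+[b+n]-+b∣≡n : ∀ b n → ℤ.∣ + (b + n) ℤ.- + b ∣ ≡ n
∣+[b+n]-+b∣≡n b n = begin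
  ℤ.∣ + (b + n) ℤ.- + b ∣  ≡⟨ cong ℤ.∣_∣ (ℤₚ.[+m]-[+n]≡m⊖n (b + n) b) ⟩
  ℤ.∣ (b + n) ℤ.⊖ b ∣      ≡⟨ cong ℤ.∣_∣ (ℤₚ.⊖-≥ (m≤m+n b n)) ⟩
  b + n ∸ b                ≡⟨ m+n∸m≡n b n ⟩
  n                        ∎
  where open ≡-Reasoning

∣+a-[-+b]∣≡a+b : ∀ a b → ℤ.∣ + a ℤ.- ℤ.- + b ∣ ≡ a + b
∣+a-[-+b]∣≡a+b a b =
  cong ℤ.∣_∣ (trans (cong (ℤ._+_ (+ a)) (ℤₚ.neg-involutive (+ b))) (sym (ℤₚ.pos-+ a b)))

+≡+[mod] : ∀ {a b m c} → a ≡ b + m * c → (+ a) ≡ (+ b) [mod m ]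
+≡+[mod] {b = b} {m} {c} refl = subst (m ∣_) (sym (∣+[b+n]-+b∣≡n b (m * c))) (m∣m*n c)

+≡-[mod] : ∀ {a b m c} → b + a ≡ m * c → (+ a) ≡ ℤ.- (+ b) [mod m ]
+≡-[mod] {a} {b} {m} {c} b+a≡mc =
  subst (m ∣_) (sym (trans (∣+a-[-+b]∣≡a+b a b) (trans (+-comm a b) b+a≡mc))) (m∣m*n c)

≡[mod]-complement : ∀ {a x y m} {t : ℤ} → x + y ≡ m →
  (+ (a * x)) ≡ t [mod m ] → (+ (a * y)) ≡ ℤ.- t [mod m ]
≡[mod]-complement {a} {x} {y} {m} {t} x+y≡m ax≡t =
  Signed.∣⇒∣ᵤ (subst (Signed._∣_ (+ m)) am-[ax-t]≡ay+t
  (Signed.∣m∣n⇒∣m-n (Signed.∣n⇒∣m*n (+ a) Signed.∣-refl) (Signed.∣ᵤ⇒∣ {i = + (a * x) ℤ.- t} ax≡t)))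
  where
    open ≡-Reasoning
    am-[ax-t]≡ay+t : + a ℤ.* + m ℤ.- (+ (a * x) ℤ.- t) ≡ + (a * y) ℤ.- ℤ.- t
    am-[ax-t]≡ay+t = begin
      + a ℤ.* + m ℤ.- (+ (a * x) ℤ.- t)
        ≡⟨ cong₂ (λ M AX → + a ℤ.* M ℤ.- (AX ℤ.- t))
                 (trans (cong +_ (sym x+y≡m)) (ℤₚ.pos-+ x y)) (ℤₚ.pos-* a x) ⟩
      + a ℤ.* (+ x ℤ.+ + y) ℤ.- (+ a ℤ.* + x ℤ.- t)
        ≡⟨ ring-identity (+ a) (+ x) (+ y) t ⟩
      + a ℤ.* + y ℤ.- ℤ.- t
        ≡⟨ cong (λ AY → AY ℤ.- ℤ.- t) (ℤₚ.pos-* a y) ⟨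
      + (a * y) ℤ.- ℤ.- t ∎
      where
        ring-identity : ∀ A X Y T → A ℤ.* (X ℤ.+ Y) ℤ.- (A ℤ.* X ℤ.- T) ≡ A ℤ.* Y ℤ.- ℤ.- T
        ring-identity = ℤ-solve-∀

m∣n∧n<m⇒n≡0 : ∀ {m n} → m ∣ n → n < m → n ≡ 0
m∣n∧n<m⇒n≡0 {n = 0}     _   _   = refl
m∣n∧n<m⇒n≡0 {n = suc _} m∣n n<m = contradiction m∣n (>⇒∤ n<m)

≡[mod]-cancel : ∀ {m a x y} {t : ℤ} → Coprime m a → x < m → y < m →
  (+ (a * x)) ≡ t [mod m ] → (+ (a * y)) ≡ t [mod m ] → x ≡ y
≡[mod]-cancel {m} {a} {x} {y} {t} m⊥a x<m y<m ax≡t ay≡t =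
  ℤₚ.+-injective (ℤₚ.i-j≡0⇒i≡j (+ x) (+ y) (ℤₚ.∣i∣≡0⇒i≡0 (m∣n∧n<m⇒n≡0 m∣∣x-y∣ ∣x-y∣<m)))
  where
    [ax-t]-[ay-t]≡a[x-y] : (+ (a * x) ℤ.- t) ℤ.- (+ (a * y) ℤ.- t) ≡ + a ℤ.* (+ x ℤ.- + y)
    [ax-t]-[ay-t]≡a[x-y] = trans
      (cong₂ (λ AX AY → (AX ℤ.- t) ℤ.- (AY ℤ.- t)) (ℤₚ.pos-* a x) (ℤₚ.pos-* a y))
      (ring-identity (+ a) (+ x) (+ y) t)
      where
        ring-identity : ∀ A X Y T → (A ℤ.* X ℤ.- T) ℤ.- (A ℤ.* Y ℤ.- T) ≡ A ℤ.* (X ℤ.- Y)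
        ring-identity = ℤ-solve-∀
    m∣∣a[x-y]∣ : m ∣ ℤ.∣ + a ℤ.* (+ x ℤ.- + y) ∣
    m∣∣a[x-y]∣ = Signed.∣⇒∣ᵤ (subst (Signed._∣_ (+ m)) [ax-t]-[ay-t]≡a[x-y]
      (Signed.∣m∣n⇒∣m-n (Signed.∣ᵤ⇒∣ {i = + (a * x) ℤ.- t} ax≡t)
                        (Signed.∣ᵤ⇒∣ {i = + (a * y) ℤ.- t} ay≡t)))
    m∣∣x-y∣ : m ∣ ℤ.∣ + x ℤ.- + y ∣
    m∣∣x-y∣ = ℤCoprimality.coprime-divisor (+ m) (+ a) (+ x ℤ.- + y) m⊥a m∣∣a[x-y]∣
    ∣x-y∣<m : ℤ.∣ + x ℤ.- + y ∣ < m
    ∣x-y∣<m = begin-strict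
      ℤ.∣ + x ℤ.- + y ∣  ≡⟨ cong ℤ.∣_∣ (ℤₚ.[+m]-[+n]≡m⊖n x y) ⟩
      ℤ.∣ x ℤ.⊖ y ∣      ≤⟨ ℤₚ.∣m⊝n∣≤m⊔n x y ⟩
      x ⊔ y              <⟨ ⊔-lub x<m y<m ⟩
      m                  ∎
      where open ≤-Reasoning

charPos+charNeg≡m : ∀ {m a b x y} → Coprime m a → IsCharPos m a b x → IsCharNeg m a b y → x + y ≡ m
charPos+charNeg≡m {m} {a} {b} {x} {y} m⊥a (_ , x<m , ax≡b) (0<y , y<m , ay≡-b) = begin
  x + y        ≡⟨ cong (_+ y) x≡m∸y ⟩
  m ∸ y + y    ≡⟨ m∸n+n≡m (<⇒≤ y<m) ⟩
  m            ∎
  where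
    open ≡-Reasoning
    a[m∸y]≡--b : (+ (a * (m ∸ y))) ≡ ℤ.- (ℤ.- (+ b)) [mod m ]
    a[m∸y]≡--b = ≡[mod]-complement {a} {y} {m ∸ y} {t = ℤ.- (+ b)}
      (trans (+-comm y (m ∸ y)) (m∸n+n≡m (<⇒≤ y<m))) ay≡-b
    a[m∸y]≡b : (+ (a * (m ∸ y))) ≡ (+ b) [mod m ]
    a[m∸y]≡b = subst (λ t → (+ (a * (m ∸ y))) ≡ t [mod m ]) (ℤₚ.neg-involutive (+ b)) a[m∸y]≡--b
    x≡m∸y : x ≡ m ∸ y
    x≡m∸y = ≡[mod]-cancel {t = + b} m⊥a x<m (∸-monoʳ-< 0<y (<⇒≤ y<m)) ax≡b a[m∸y]≡b

m+n≡o∧2n<o⇒o<2m : ∀ {m n o} → m + n ≡ o → 2 * n < o → o < 2 * m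
m+n≡o∧2n<o⇒o<2m {m} {n} refl 2n<m+n = begin-strict
  m + n  <⟨ +-monoʳ-< m n<m ⟩
  m + m  ≡⟨ solve (m ∷ []) ⟩
  2 * m  ∎
  where
    open ≤-Reasoning
    n<m : n < m
    n<m = +-cancelʳ-< n n m (begin-strict
      n + n  ≡⟨ solve (n ∷ []) ⟩
      2 * n  <⟨ 2n<m+n ⟩
      m + n  ∎)

form-quotient-pos : ∀ {k a b c n} → 0 < a → c * n ≡ a * a + k * a * b + b * b → 0 < n
form-quotient-pos {n = suc _} _ _ = s≤s z≤n
form-quotient-pos {a = suc _} {c = c} {n = 0} _ cn≡form with () ← trans (sym (*-zeroʳ c)) cn≡form

∣-coprime-square⇒≡1 : ∀ {a b d} → Coprime a b → d ∣ a → d ∣ b * b → d ≡ 1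
∣-coprime-square⇒≡1 a⊥b d∣a d∣b² =
  a⊥b (d∣a , Coprimality.coprime-divisor (λ (e∣d , e∣b) → a⊥b (∣-trans e∣d d∣a , e∣b)) d∣b²)

coprime-form-quotientˡ : ∀ {k a b c n} → Coprime a b → c * n ≡ a * a + k * a * b + b * b →
  Coprime a n
coprime-form-quotientˡ {k} {a} {b} {c} a⊥b cn≡form {d} (d∣a , d∣n) = ∣-coprime-square⇒≡1 a⊥b d∣a
  (∣m+n∣m⇒∣n (subst (d ∣_) cn≡form (∣n⇒∣m*n c d∣n))
             (∣m∣n⇒∣m+n (∣m⇒∣m*n a d∣a) (∣m⇒∣m*n b (∣n⇒∣m*n k d∣a))))

coprime-form-quotientʳ : ∀ {k a b c n} → Coprime a b → c * n ≡ a * a + k * a * b + b * b →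
  Coprime n b
coprime-form-quotientʳ {k} {a} {b} {c} a⊥b cn≡form =
  Coprimality.sym (coprime-form-quotientˡ {k} {c = c} (Coprimality.sym a⊥b)
    (trans cn≡form (solve (k ∷ a ∷ b ∷ []))))

coprime-cofactor : ∀ {a b d e X} .{{_ : NonZero a}} → Coprime a b → a * e ≡ a * d + b * X →
  Σ[ q ∈ ℕ ] a * q ≡ X × e ≡ d + b * q
coprime-cofactor {a} {b} {d} {e} {X} a⊥b ae≡ad+bX with
  Coprimality.coprime-divisor a⊥b (∣m+n∣m⇒∣n (subst (a ∣_) ae≡ad+bX (m∣m*n e)) (m∣m*n d))
... | divides q refl = q , *-comm a q , *-cancelˡ-≡ e (d + b * q) a (begin
  a * e                ≡⟨ ae≡ad+bX ⟩
  a * d + b * (q * a)  ≡⟨ solve (a ∷ b ∷ d ∷ q ∷ []) ⟩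
  a * (d + b * q)      ∎)
  where open ≡-Reasoning

mutate-cofactor : ∀ {k a b c n P q} .{{_ : NonZero a}} → Coprime a b →
  a * q ≡ c + b * P → c * n ≡ a * a + k * a * b + b * b →
  Σ[ q′ ∈ ℕ ] a * q′ ≡ b + n * P × n * q ≡ a + b * (q′ + k)
mutate-cofactor {k} {a} {b} {c} {n} {P} {q} a⊥b aq≡c+bP cn≡form
  with coprime-cofactor a⊥b a[nq]≡a[a+kb]+b[b+nP]
  where
    open ≡-Reasoning
    a[nq]≡a[a+kb]+b[b+nP] : a * (n * q) ≡ a * (a + k * b) + b * (b + n * P)
    a[nq]≡a[a+kb]+b[b+nP] = begin
      a * (n * q)                          ≡⟨ solve (a ∷ n ∷ q ∷ []) ⟩
      n * (a * q)                          ≡⟨ cong (n *_) aq≡c+bP ⟩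
      n * (c + b * P)                      ≡⟨ solve (n ∷ c ∷ b ∷ P ∷ []) ⟩
      c * n + b * (n * P)                  ≡⟨ cong (_+ b * (n * P)) cn≡form ⟩
      a * a + k * a * b + b * b + b * (n * P)  ≡⟨ solve (a ∷ b ∷ k ∷ n ∷ P ∷ []) ⟩
      a * (a + k * b) + b * (b + n * P)    ∎
... | q′ , aq′≡b+nP , nq≡a+kb+bq′ =
  q′ , aq′≡b+nP , trans nq≡a+kb+bq′ (solve (a ∷ b ∷ k ∷ q′ ∷ []))

record Invariant (k x y z : ℕ) : Set where
  field
    P q w       : ℕ
    xq≡z+yP     : x * q ≡ z + y * P
    yw≡x+z[q+k] : y * w ≡ x + z * (q + k)
    x>0         : 0 < x
    y>0         : 0 < y
    x⊥y         : Coprime x y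
    y⊥z         : Coprime y z

root-invariant : ∀ k → Invariant k 1 (k + 2) 1
root-invariant k = record
  { P = 0 ; q = 1 ; w = 1
  ; xq≡z+yP = solve (k ∷ [])
  ; yw≡x+z[q+k] = solve (k ∷ [])
  ; x>0 = s≤s z≤n
  ; y>0 = subst (0 <_) (+-comm 2 k) (s≤s z≤n)
  ; x⊥y = Coprimality.1-coprimeTo (k + 2)
  ; y⊥z = Coprimality.sym (Coprimality.1-coprimeTo (k + 2))
  }

left-invariant : ∀ {k x y z n} → Invariant k x y z → z * n ≡ x * x + k * x * y + y * y →
  Invariant k x n y
left-invariant {k} {x} {y} {z} {n} I zn≡form = record
  { P = P ; q = proj₁ mutation ; w = q
  ; xq≡z+yP = proj₁ (proj₂ mutation)
  ; yw≡x+z[q+k] = proj₂ (proj₂ mutation)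
  ; x>0 = x>0
  ; y>0 = form-quotient-pos {k} {c = z} x>0 zn≡form
  ; x⊥y = coprime-form-quotientˡ {k} {c = z} x⊥y zn≡form
  ; y⊥z = coprime-form-quotientʳ {k} {c = z} x⊥y zn≡form
  }
  where
    open Invariant I
    instance _ = >-nonZero x>0
    mutation = mutate-cofactor x⊥y xq≡z+yP zn≡form

-- The second identity of I is the first one for the triple (y, z, x) with P = q + k.
right-invariant : ∀ {k x y z n} → Invariant k x y z → x * n ≡ y * y + k * y * z + z * z →
  Invariant k y n z
right-invariant {k} {x} {y} {z} {n} I xn≡form = record
  { P = q + k ; q = proj₁ mutation ; w = w
  ; xq≡z+yP = proj₁ (proj₂ mutation)
  ; yw≡x+z[q+k] = proj₂ (proj₂ mutation)
  ; x>0 = y>0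
  ; y>0 = form-quotient-pos {k} {c = x} y>0 xn≡form
  ; x⊥y = coprime-form-quotientˡ {k} {c = x} y⊥z xn≡form
  ; y⊥z = coprime-form-quotientʳ {k} {c = x} y⊥z xn≡form
  }
  where
    open Invariant I
    instance _ = >-nonZero y>0
    mutation = mutate-cofactor y⊥z yw≡x+z[q+k] xn≡form

invariant : ∀ {k p x y z} → MT k p x y z → Invariant k x y z
invariant root = root-invariant _
invariant (left m cn≡form) = left-invariant (invariant m) cn≡form
invariant (right m an≡form) = right-invariant (invariant m) an≡form

data InSubtree (d : Dir) : Path → Set where
  child   : InSubtree d (d ∷ [])
  descend : ∀ {e p} → InSubtree d p → InSubtree d (e ∷ p)

AtLeastOne : Frac → Set
AtLeastOne (a , b) = b ≤ a

mediant-≥1 : ∀ {f g} → AtLeastOne f → AtLeastOne g → AtLeastOne (mediant f g)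
mediant-≥1 = +-mono-≤

AllAtLeastOne : Frac × Frac × Frac → Set
AllAtLeastOne (r , t , s) = AtLeastOne r × AtLeastOne t × AtLeastOne s

right-subtree-≥1 : ∀ {p} → InSubtree R p → AllAtLeastOne (farey p)
right-subtree-≥1 child = s≤s z≤n , s≤s z≤n , z≤n
right-subtree-≥1 (descend {e = L} t) with right-subtree-≥1 t
... | r≥1 , t≥1 , _ = r≥1 , mediant-≥1 r≥1 t≥1 , t≥1
right-subtree-≥1 (descend {e = R} t) with right-subtree-≥1 t
... | _ , t≥1 , s≥1 = t≥1 , mediant-≥1 t≥1 s≥1 , s≥1

left-or-right-subtree : ∀ d p → InSubtree L (d ∷ p) ⊎ InSubtree R (d ∷ p)
left-or-right-subtree L []      = inj₁ child
left-or-right-subtree R []      = inj₂ child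
left-or-right-subtree d (e ∷ p) = Sum.map descend descend (left-or-right-subtree e p)

farey-<1⇒left-subtree : ∀ p {r s a b} → farey p ≡ (r , (a , b) , s) → a < b → InSubtree L p
farey-<1⇒left-subtree []      refl a<b = contradiction a<b (<-irrefl refl)
farey-<1⇒left-subtree (d ∷ p) eq   a<b with left-or-right-subtree d p
... | inj₁ inL = inL
... | inj₂ inR =
  contradiction (proj₁ (proj₂ (subst AllAtLeastOne eq (right-subtree-≥1 inR)))) (<⇒≱ a<b)

cofactor-bound : ∀ {k x y z q w} → 0 < x → y * w ≡ x + z * (q + k) → (2 + k) * w ≤ z →
  (2 + k) * (q + k) < y
cofactor-bound {k} {x} {y} {z} {q} {w} x>0 yw≡x+z[q+k] [2+k]w≤z = *-cancelˡ-< z _ _ (begin-strict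
  z * ((2 + k) * (q + k))                  <⟨ m<m+n _ (<-≤-trans x>0 (m≤m+n x _)) ⟩
  z * ((2 + k) * (q + k)) + (2 + k) * x    ≡⟨ solve (k ∷ x ∷ z ∷ q ∷ []) ⟩
  (2 + k) * (x + z * (q + k))              ≡⟨ cong ((2 + k) *_) yw≡x+z[q+k] ⟨
  (2 + k) * (y * w)                        ≡⟨ solve (k ∷ y ∷ w ∷ []) ⟩
  y * ((2 + k) * w)                        ≤⟨ *-monoʳ-≤ y [2+k]w≤z ⟩
  y * z                                    ≡⟨ *-comm y z ⟩
  z * y                                    ∎)
  where open ≤-Reasoning

-- Fails at the root (w = z = 1).  A left mutation makes (q, y) the new (w, z); a right one
-- keeps w and z.
Balanced : ∀ {k x y z} → Invariant k x y z → Set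
Balanced {k} {z = z} I = (2 + k) * Invariant.w I ≤ z

balanced : ∀ {k p x y z} → InSubtree L p → (m : MT k p x y z) → Balanced (invariant m)
left-subtree-bound : ∀ {k p x y z} → InSubtree L p → (m : MT k p x y z) →
  (2 + k) * (Invariant.q (invariant m) + k) < y

balanced {k} child (left root _) = ≤-reflexive (trans (*-identityʳ (2 + k)) (+-comm 2 k))
balanced {k} (descend {e = L} t) (left m _) =
  ≤-trans (*-monoʳ-≤ (2 + k) (m≤m+n q k)) (<⇒≤ (left-subtree-bound t m))
  where open Invariant (invariant m)
balanced (descend {e = R} t) (right m _) = balanced t m

left-subtree-bound {k} t m = cofactor-bound {k} {q = q} x>0 yw≡x+z[q+k] (balanced t m)
  where open Invariant (invariant m)

charPos≡q : ∀ {k x y z u} (I : Invariant k x y z) → Invariant.q I < y → IsCharPos y x z u →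
  u ≡ Invariant.q I
charPos≡q {z = z} I q<y (_ , u<y , xu≡z) =
  ≡[mod]-cancel {t = + z} (Coprimality.sym x⊥y) u<y q<y xu≡z (+≡+[mod] {b = z} {c = P} xq≡z+yP)
  where open Invariant I

charNeg≡q+k : ∀ {k x y z v} (I : Invariant k x y z) → Invariant.q I + k < y → IsCharNeg y z x v →
  v ≡ Invariant.q I + k
charNeg≡q+k {x = x} I q+k<y (_ , v<y , zv≡-x) =
  ≡[mod]-cancel {t = ℤ.- (+ x)} y⊥z v<y q+k<y zv≡-x (+≡-[mod] {b = x} {c = w} (sym yw≡x+z[q+k]))
  where open Invariant I

proposition7p22 : (k : ℕ) (a b : ℕ) → Coprime a b → 0 < a → a < b →
    (p : Path) → (r s : Frac) → farey p ≡ (r , (a , b) , s) →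
    (mr mt ms : ℕ) → MT k p mr mt ms →
    (u⁺ u⁻ v⁺ v⁻ : ℕ) →
    IsCharPos mt mr ms u⁺ → IsCharNeg mt mr ms u⁻ →
    IsCharPos mt ms mr v⁺ → IsCharNeg mt ms mr v⁻ →
    ((0 < u⁺ × 2 * u⁺ < mt) × (0 < v⁻ × 2 * v⁻ < mt) ×
     (mt < 2 * u⁻ × u⁻ < mt) × (mt < 2 * v⁺ × v⁺ < mt)) ×
    (u⁻ + u⁺ ≡ mt × v⁺ + u⁺ + k ≡ mt × v⁻ ≡ u⁺ + k)
proposition7p22 k a b _ _ a<b p r s farey-p mr mt ms m u⁺ u⁻ v⁺ v⁻ cu⁺ cu⁻ cv⁺ cv⁻ =
  ( (proj₁ cu⁺ , 2u⁺<mt) , (proj₁ cv⁻ , 2v⁻<mt)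
  , (m+n≡o∧2n<o⇒o<2m {u⁻} {u⁺} u⁻+u⁺≡mt 2u⁺<mt , proj₁ (proj₂ cu⁻))
  , (m+n≡o∧2n<o⇒o<2m {v⁺} {v⁻} v⁺+v⁻≡mt 2v⁻<mt , proj₁ (proj₂ cv⁺)) )
  , (u⁻+u⁺≡mt , v⁺+u⁺+k≡mt , v⁻≡u⁺+k)
  where
    open Invariant (invariant m)
    2[q+k]<mt : 2 * (q + k) < mt
    2[q+k]<mt = ≤-<-trans (*-monoˡ-≤ (q + k) (m≤m+n 2 k))
      (left-subtree-bound (farey-<1⇒left-subtree p farey-p a<b) m)
    q+k<mt : q + k < mt
    q+k<mt = ≤-<-trans (m≤n*m (q + k) 2) 2[q+k]<mt
    u⁺≡q : u⁺ ≡ q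
    u⁺≡q = charPos≡q (invariant m) (≤-<-trans (m≤m+n q k) q+k<mt) cu⁺
    v⁻≡q+k : v⁻ ≡ q + k
    v⁻≡q+k = charNeg≡q+k (invariant m) q+k<mt cv⁻
    v⁻≡u⁺+k : v⁻ ≡ u⁺ + k
    v⁻≡u⁺+k = trans v⁻≡q+k (cong (_+ k) (sym u⁺≡q))
    2u⁺<mt : 2 * u⁺ < mt
    2u⁺<mt = ≤-<-trans (*-monoʳ-≤ 2 (subst (_≤ q + k) (sym u⁺≡q) (m≤m+n q k))) 2[q+k]<mt
    2v⁻<mt : 2 * v⁻ < mt
    2v⁻<mt = subst (λ v → 2 * v < mt) (sym v⁻≡q+k) 2[q+k]<mt
    u⁻+u⁺≡mt : u⁻ + u⁺ ≡ mt
    u⁻+u⁺≡mt = trans (+-comm u⁻ u⁺) (charPos+charNeg≡m {b = ms} (Coprimality.sym x⊥y) cu⁺ cu⁻)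
    v⁺+v⁻≡mt : v⁺ + v⁻ ≡ mt
    v⁺+v⁻≡mt = charPos+charNeg≡m {b = mr} y⊥z cv⁺ cv⁻
    v⁺+u⁺+k≡mt : v⁺ + u⁺ + k ≡ mt
    v⁺+u⁺+k≡mt = trans (+-assoc v⁺ u⁺ k) (trans (cong (_+_ v⁺) (sym v⁻≡u⁺+k)) v⁺+v⁻≡mt)
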